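{- Every set $\Gamma$ of conditional formulas is $\mathsf{CnCK}$-satisfiable: there is a conditional Fischer-Servi model and a world $w$ with $w\models^+\phi$ for all $\phi\in\Gamma$ (i.e. $\Gamma\not\models_{\mathsf{CnCK}}\emptyset$).
   Context: Conditional formulas are built from propositional letters with $\wedge,\vee,\to$, $\sim$ (strong negation), and binary $\mathbin{\Box\!\!\to}$, $\mathbin{\Diamond\!\!\to}$. A conditional Fischer-Servi model is $(W,\leq,R,V^+,V^-)$, $W\neq\emptyset$, $\leq$ a preorder, $R\subseteq W\times(\mathcal{P}(W))^2\times W$, $V^\pm$ maps letters to $\leq$-upward closed sets, such that for all $X,Y\subseteq W$, $R_{(X,Y)}=\{(w,v)\mid R(w,(X,Y),v)\}$ satisfies (c1) $w\leq w'$, $wR_{(X,Y)}v$ imply $w'R_{(X,Y)}v'$, $v\leq v'$ for some $v'$; (c2) $wR_{(X,Y)}v$, $v\leq v'$ imply $w\leq w'$, $w'R_{(X,Y)}v'$ for some $w'$. Satisfaction: $w\models^\pm p$ iff $w\in V^\pm(p)$; $\wedge$: $+$ iff both $+$, $-$ iff some $-$; $\vee$: $+$ iff some $+$, $-$ iff both $-$; $w\models^\pm\sim\psi$ iff $w\models^\mp\psi$; $w\models^+\psi\to\chi$ iff $\forall v\geq w(v\models^+\psi\Rightarrow v\models^+\chi)$; $w\models^-\psi\to\chi$ iff $\forall v\geq w(v\models^+\psi\Rightarrow v\models^-\chi)$; with $\|\psi\|=(\{w\mid w\models^+\psi\},\{w\mid w\models^-\psi\})$: $w\models^\pm\psi\mathbin{\Box\!\!\to}\chi$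 iff $\forall v\geq w\,\forall u(vR_{\|\psi\|}u\Rightarrow u\models^\pm\chi)$; $w\models^\pm\psi\mathbin{\Diamond\!\!\to}\chi$ iff $\exists u(wR_{\|\psi\|}u$ and $u\models^\pm\chi)$. $\Gamma\models_{\mathsf{CnCK}}\Delta$ iff no world verifies all of $\Gamma$ and none of $\Delta$. -}

module Defs where

open import Data.Nat using (ℕ)
open import Data.Product using (Σ; _×_; _,_; ∃)
open import Data.Sum using (_⊎_)

Atom : Set
Atom = ℕ

infixr 6 _∧_
infixr 5 _∨_
infixr 4 _⇒_ _□→_ _◇→_

data Formula : Set where
  var  : Atom → Formula
  _∧_  : Formula → Formula → Formula
  _∨_  : Formula → Formula → Formula
  _⇒_  : Formula → Formula → Formula
  ∼_   : Formula → Formula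
  _□→_ : Formula → Formula → Formula
  _◇→_ : Formula → Formula → Formula

Subset : Set → Set₁
Subset W = W → Set

record CFSModel : Set₁ where
  field
    W      : Set
    inhabitant : W
    _≤_    : W → W → Set
    ≤-refl : ∀ {w} → w ≤ w
    ≤-trans : ∀ {u v w} → u ≤ v → v ≤ w → u ≤ w
    R      : W → Subset W → Subset W → W → Set
    V⁺     : Atom → Subset W
    V⁻     : Atom → Subset W
    V⁺-up  : ∀ p {w v} → V⁺ p w → w ≤ v → V⁺ p v
    V⁻-up  : ∀ p {w v} → V⁻ p w → w ≤ v → V⁻ p v
    c1 : ∀ (X Y : Subset W) {w w' v} → w ≤ w' → R w X Y v →
         Σ W (λ v' → R w' X Y v' × v ≤ v')
    c2 : ∀ (X Y : Subset W) {w v v'} → R w X Y v → v ≤ v' →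
         Σ W (λ w' → w ≤ w' × R w' X Y v')

data Sign : Set where
  pos neg : Sign

flip : Sign → Sign
flip pos = neg
flip neg = pos

module _ (M : CFSModel) where
  open CFSModel M

  -- sat s w φ  means  w ⊨^s φ  (s = pos for ⊨⁺, neg for ⊨⁻)
  sat : Sign → W → Formula → Set
  sat pos w (var p) = V⁺ p w
  sat neg w (var p) = V⁻ p w
  sat pos w (φ ∧ ψ) = sat pos w φ × sat pos w ψ
  sat neg w (φ ∧ ψ) = sat neg w φ ⊎ sat neg w ψ
  sat pos w (φ ∨ ψ) = sat pos w φ ⊎ sat pos w ψ
  sat neg w (φ ∨ ψ) = sat neg w φ × sat neg w ψ
  sat s w (∼ φ) = sat (flip s) w φ
  sat pos w (φ ⇒ ψ) = ∀ v → w ≤ v → sat pos v φ → sat pos v ψ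
  sat neg w (φ ⇒ ψ) = ∀ v → w ≤ v → sat pos v φ → sat neg v ψ
  sat s w (φ □→ ψ) =
    ∀ v → w ≤ v → ∀ u → R v (λ x → sat pos x φ) (λ x → sat neg x φ) u → sat s u ψ
  sat s w (φ ◇→ ψ) =
    Σ W (λ u → R w (λ x → sat pos x φ) (λ x → sat neg x φ) u × sat s u ψ)

CnCK-satisfiable : (Formula → Set) → Set₁
CnCK-satisfiable Γ =
  Σ CFSModel (λ M → Σ (CFSModel.W M) (λ w → ∀ φ → Γ φ → sat M pos w φ))

{-# OPTIONS --safe #-}
module Submission where

open import Defs
open import Data.Unit using (⊤; tt)
open import Data.Product using (Σ; _×_; _,_)
open import Data.Sum using (inj₁)

-- Strong negation is not explosive: a world may verify and falsify a letter at
-- once.  If every letter is glutted everywhere and every R_(X,Y) is serial, then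
-- every formula is glutted everywhere, by induction on the formula; seriality is
-- what witnesses the existential clause of ◇→.  The one-point model is such a
-- model, and its world satisfies every set of formulas.

module _ (M : CFSModel) where

  open CFSModel M

  module _ (V⁺-total : ∀ p w → V⁺ p w) (V⁻-total : ∀ p w → V⁻ p w)
           (R-serial : ∀ X Y w → Σ W (R w X Y)) where

    sat-everywhere : ∀ s w φ → sat M s w φ
    diamond-witness : ∀ s w φ ψ →
      Σ W (λ u → R w (λ x → sat M pos x φ) (λ x → sat M neg x φ) u × sat M s u ψ)

    diamond-witness s w φ ψ with R-serial (λ x → sat M pos x φ) (λ x → sat M neg x φ) w
    ... | u , wRu = u , wRu , sat-everywhere s u ψ

    sat-everywhere pos w (var p)   = V⁺-total p w
    sat-everywhere neg w (var p)   = V⁻-total p w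
    sat-everywhere pos w (φ ∧ ψ)   = sat-everywhere pos w φ , sat-everywhere pos w ψ
    sat-everywhere neg w (φ ∧ ψ)   = inj₁ (sat-everywhere neg w φ)
    sat-everywhere pos w (φ ∨ ψ)   = inj₁ (sat-everywhere pos w φ)
    sat-everywhere neg w (φ ∨ ψ)   = sat-everywhere neg w φ , sat-everywhere neg w ψ
    sat-everywhere pos w (φ ⇒ ψ)   = λ v _ _ → sat-everywhere pos v ψ
    sat-everywhere neg w (φ ⇒ ψ)   = λ v _ _ → sat-everywhere neg v ψ
    sat-everywhere pos w (∼ φ)     = sat-everywhere neg w φ
    sat-everywhere neg w (∼ φ)     = sat-everywhere pos w φ
    sat-everywhere pos w (φ □→ ψ)  = λ _ _ u _ → sat-everywhere pos u ψ
    sat-everywhere neg w (φ □→ ψ)  = λ _ _ u _ → sat-everywhere neg u ψ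
    sat-everywhere pos w (φ ◇→ ψ)  = diamond-witness pos w φ ψ
    sat-everywhere neg w (φ ◇→ ψ)  = diamond-witness neg w φ ψ

pointModel : CFSModel
pointModel = record
  { W = ⊤ ; inhabitant = tt
  ; _≤_ = λ _ _ → ⊤ ; ≤-refl = tt ; ≤-trans = λ _ _ → tt
  ; R = λ _ _ _ _ → ⊤
  ; V⁺ = λ _ _ → ⊤ ; V⁻ = λ _ _ → ⊤
  ; V⁺-up = λ _ _ _ → tt ; V⁻-up = λ _ _ _ → tt
  ; c1 = λ _ _ _ _ → tt , tt , tt ; c2 = λ _ _ _ _ → tt , tt , tt
  }

proposition5p17 : (Γ : Formula → Set) → CnCK-satisfiable Γ
proposition5p17 Γ = pointModel , tt , λ φ _ → sat-pointModel φ
  where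
  sat-pointModel : ∀ φ → sat pointModel pos tt φ
  sat-pointModel = sat-everywhere pointModel (λ _ _ → tt) (λ _ _ → tt)
                                  (λ _ _ _ → tt , tt) pos tt
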